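{- Let $G$ be a finite abelian group acting on itself by translation, and let $H$ be a subgroup of $G$. Let $k$ be a positive integer. Suppose that $A=A_1\cup\dots\cup A_k$, where for each $i$ the set $A_i$ is contained in a coset $g_iH$ of $H$, these $k$ cosets being pairwise distinct. Suppose likewise that $B=B_1\cup\dots\cup B_k$, where for each $i$ the set $B_i$ is contained in a coset $g'_iH$ of $H$, these $k$ cosets being pairwise distinct. Suppose finally that for each $1\le i\le k$, the sets $A\setminus A_i$ and $B\setminus B_i$ are translates of each other (i.e. $B\setminus B_i=x+(A\setminus A_i)$ for some $x\in G$). Then $A$ and $B$ are $(k-1)$-indistinguishable.
   Context: For a subset $T\subseteq G$ and an integer $j\ge 0$, let $T^{(j)}$ denote the set of $j$-element subsets of $T$. The $j$-deck of $T$ is the multiset $\{\{\{g+U: g\in G\} : U\in T^{(j)}\}\}$ of all $j$-element subsets of $T$, each taken up to translation by $G$. Two subsets $T_1,T_2$ are $m$-indistinguishable if their $j$-decks coincide for all $j\le m$, and $m$-distinguishable otherwise. -}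

module Defs where

open import Data.Nat using (ℕ; zero; suc)
open import Data.Bool using (Bool; true; false)
open import Data.Bool.Properties using () renaming (_≟_ to _≟ᵇ_)
open import Data.Fin using (Fin)
open import Data.Fin.Subset using (Subset; _∈_; _∪_; ∣_∣; ⊥)
open import Data.Fin.Subset.Properties using (_⊆?_)
open import Data.Fin.Subset using (_⊆_)
open import Data.Vec using (Vec; []; _∷_; tabulate; lookup)
open import Data.Vec.Properties using (≡-dec)
open import Data.List using (List; []; _∷_; _++_; map; filter; length; allFin)
open import Data.Fin.Properties using (any?)
open import Data.Product using (Σ; ∃; _×_; _,_)
open import Relation.Binary.PropositionalEquality using (_≡_)
open import Relation.Binary.Definitions using (DecidableEquality)
open import Relation.Nullary using (Dec; ¬_)
open import Relation.Nullary.Decidable using (_×-dec_)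
open import Algebra.Core using (Op₁; Op₂)
open import Algebra.Structures using (IsAbelianGroup)
import Data.Nat as ℕ

-- A finite abelian group of order n, its elements labelled by Fin n
-- (every finite abelian group is isomorphic to one of this form).
record FinAbGroup (n : ℕ) : Set where
  infixl 6 _+_
  field
    _+_ : Op₂ (Fin n)
    0#  : Fin n
    -_  : Op₁ (Fin n)
    isAbelianGroup : IsAbelianGroup _≡_ _+_ 0# -_

module _ {n : ℕ} (G : FinAbGroup n) where
  open FinAbGroup G

  record IsSubgroup (H : Subset n) : Set where
    field
      0∈H : 0# ∈ H
      +-closed : ∀ {x y} → x ∈ H → y ∈ H → (x + y) ∈ H
      neg-closed : ∀ {x} → x ∈ H → (- x) ∈ H

  -- translate g + U = { g + u : u ∈ U }, i.e. x ∈ g + U iff x - g ∈ U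
  translate : Fin n → Subset n → Subset n
  translate g U = tabulate (λ x → lookup U (x + (- g)))

  coset : Subset n → Fin n → Subset n
  coset H g = translate g H

  IsTranslateOf : Subset n → Subset n → Set
  IsTranslateOf V U = ∃ λ g → V ≡ translate g U

  isTranslateOf? : ∀ V U → Dec (IsTranslateOf V U)
  isTranslateOf? V U = any? (λ g → ≡-dec _≟ᵇ_ V (translate g U))

allSubsets : (n : ℕ) → List (Subset n)
allSubsets zero = [] ∷ []
allSubsets (suc n) = map (true ∷_) (allSubsets n) ++ map (false ∷_) (allSubsets n)

⋃ᶠ : ∀ {n k} → (Fin k → Subset n) → Subset n
⋃ᶠ {k = zero} f = ⊥
⋃ᶠ {k = suc k} f = f Fin.zero ∪ ⋃ᶠ (λ i → f (Fin.suc i))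

module _ {n : ℕ} (G : FinAbGroup n) where

  -- multiplicity of the translation class of U in the j-deck of T:
  -- the number of j-element subsets V ⊆ T which are translates of U
  deckCount : Subset n → ℕ → Subset n → ℕ
  deckCount T j U =
    length (filter (λ V → (V ⊆? T) ×-dec ((∣ V ∣ ℕ.≟ j) ×-dec isTranslateOf? G V U))
                   (allSubsets n))

  SameDeck : ℕ → Subset n → Subset n → Set
  SameDeck j T₁ T₂ = ∀ U → ∣ U ∣ ≡ j → deckCount T₁ j U ≡ deckCount T₂ j U

  Indistinguishable : ℕ → Subset n → Subset n → Set
  Indistinguishable m T₁ T₂ = ∀ j → j ℕ.≤ m → SameDeck j T₁ T₂

-- Write T = ⋃ᶠ As, X i = T ─ As i and h = ∣ H ∣, and let N(V) = ∣ V + H ∣. For V ⊆ T, V ⊄ X i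
-- exactly when V meets As i, and the cosets meeting V are exactly those g i + H for which V
-- meets As i; since these cosets are distinct, h · #{i | V ⊆ X i} + N(V) = k · h. As N is
-- translation invariant, summing over the j-subsets V ⊆ T in the translation class of U gives
--   d(T) · k h = h · Σᵢ d(X i) + d(T) · N(U),
-- where d counts such subsets. The hypothesis and translation invariance of decks make
-- Σᵢ d(X i) the same for A and B, and N(U) ≤ j h < k h for j < k, so d(⋃ᶠ As) = d(⋃ᶠ Bs).

module Submission where

open import Defs
open import Algebra.Bundles using (AbelianGroup)
open import Algebra.Structures using (IsAbelianGroup)
open import Data.Fin using (Fin; punchIn)
open import Data.Fin.Permutation using (permutation)
open import Data.Fin.Properties using (punchInᵢ≢i)
open import Data.Fin.Subset using (Subset; _∈_; _∉_; _⊆_; _─_; _∩_; ∣_∣; ⁅_⁆; inside; outside; Nonempty)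
open import Data.Fin.Subset.Properties
  using (_∈?_; _⊆?_; nonempty?; drop-there; ∉⊥; ⊆-antisym; p⊆q⇒∣p∣≤∣q∣; ∣⁅x⁆∣≡1; x∈⁅y⁆⇒x≡y;
         x∈p∪q⁻; x∈p∩q⁺; x∈p∩q⁻; x∈p∧x∉q⇒x∈p─q; p─q⊆p)
open import Data.List as List using (List; []; _∷_; map; length; filter)
open import Data.List.Membership.Propositional using () renaming (_∈_ to _∈ₗ_)
open import Data.List.Membership.Propositional.Properties
  using (∈-map⁺; ∈-map⁻; ∈-++⁺ˡ; ∈-++⁺ʳ; ∈-lookup; ∈-filter⁻)
open import Data.List.Membership.Propositional.Properties.WithK using (unique∧set⇒bag)
open import Data.List.Properties using (filter-≐)
open import Data.List.Relation.Binary.BagAndSetEquality using (∼bag⇒↭)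
open import Data.List.Relation.Binary.Permutation.Propositional using (_↭_)
open import Data.List.Relation.Binary.Permutation.Propositional.Properties using (↭-length; filter-↭)
import Data.List.Relation.Unary.Any as Any
open import Data.List.Relation.Unary.All using ([])
open import Data.List.Relation.Unary.AllPairs using ([]; _∷_)
open import Data.List.Relation.Unary.Unique.Propositional using (Unique)
import Data.List.Relation.Unary.Unique.Propositional.Properties as Unique
open import Data.Nat using (ℕ; zero; suc; _+_; _*_; _≤_; _<_; _∸_; z≤n; s≤s; _≟_; >-nonZero)
open import Data.Nat.Properties
open import Data.Product using (∃; _×_; _,_; proj₁; proj₂)
open import Data.Sum using (inj₁; inj₂)
open import Data.Vec using ([]; _∷_; lookup; here; there)
open import Data.Vec.Properties
  using (∷-injectiveʳ; lookup∘tabulate; tabulate∘lookup; tabulate-cong; []=⇒lookup; lookup⇒[]=)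
open import Function using (_∘_)
open import Function.Bundles using (mk⇔)
open import Level using (0ℓ)
open import Relation.Binary.PropositionalEquality
open import Relation.Nullary using (Dec; yes; no; ¬_; contradiction)
open import Relation.Nullary.Decidable using (_×-dec_)
open import Relation.Unary using (Pred; Decidable)
open import Algebra.Properties.Semiring.Sum +-*-semiring

𝟙 : ∀ {p} {P : Set p} → Dec P → ℕ
𝟙 (yes _) = 1
𝟙 (no _)  = 0

𝟙-⇔ : ∀ {p q} {P : Set p} {Q : Set q} → (P → Q) → (Q → P) →
      (P? : Dec P) (Q? : Dec Q) → 𝟙 P? ≡ 𝟙 Q?
𝟙-⇔ _   _   (yes _) (yes _) = refl
𝟙-⇔ P⇒Q _   (yes p) (no ¬q) = contradiction (P⇒Q p) ¬q
𝟙-⇔ _   Q⇒P (no ¬p) (yes q) = contradiction (Q⇒P q) ¬p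
𝟙-⇔ _   _   (no _)  (no _)  = refl

𝟙-yes : ∀ {p} {P : Set p} → P → (P? : Dec P) → 𝟙 P? ≡ 1
𝟙-yes _ (yes _) = refl
𝟙-yes p (no ¬p) = contradiction p ¬p

𝟙-no : ∀ {p} {P : Set p} → ¬ P → (P? : Dec P) → 𝟙 P? ≡ 0
𝟙-no ¬p (yes p) = contradiction p ¬p
𝟙-no _  (no _)  = refl

∑-const : ∀ k c → ∑[ i < k ] c ≡ k * c
∑-const zero    c = refl
∑-const (suc k) c = cong (c +_) (∑-const k c)

∑-zero : ∀ {k} (f : Fin k → ℕ) → (∀ i → f i ≡ 0) → ∑[ i < k ] f i ≡ 0
∑-zero {k} f f≡0 = trans (sum-cong-≗ f≡0) (sum-replicate-zero k)

∑-mono : ∀ {k} {f g : Fin k → ℕ} → (∀ i → f i ≤ g i) → ∑[ i < k ] f i ≤ ∑[ i < k ] g i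
∑-mono {zero}  f≤g = z≤n
∑-mono {suc k} f≤g = +-mono-≤ (f≤g Fin.zero) (∑-mono (f≤g ∘ Fin.suc))

term≤∑ : ∀ {k} (f : Fin k → ℕ) i → f i ≤ ∑[ j < k ] f j
term≤∑ {suc k} f i = subst (f i ≤_) (sym (sum-remove f)) (m≤m+n (f i) _)

∑-single : ∀ {k} (f : Fin k → ℕ) i → (∀ j → j ≢ i → f j ≡ 0) → ∑[ j < k ] f j ≡ f i
∑-single {suc k} f i others≡0 = begin
  sum f                       ≡⟨ sum-remove f ⟩
  f i + sum (f ∘ punchIn i)   ≡⟨ cong (f i +_) (∑-zero _ (λ j → others≡0 _ (punchInᵢ≢i i j))) ⟩
  f i + 0                     ≡⟨ +-identityʳ (f i) ⟩
  f i                         ∎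
  where open ≡-Reasoning

∑-reindex : ∀ {k} (σ τ : Fin k → Fin k) → (∀ i → σ (τ i) ≡ i) → (∀ i → τ (σ i) ≡ i) →
            ∀ f → ∑[ i < k ] f (σ i) ≡ ∑[ i < k ] f i
∑-reindex σ τ στ τσ f = sym (sum-permute f (permutation σ τ στ τσ))

𝟙-∈?-there : ∀ {n s} (p : Subset n) x → 𝟙 (x ∈? p) ≡ 𝟙 (Fin.suc x ∈? s ∷ p)
𝟙-∈?-there p x = 𝟙-⇔ there drop-there (x ∈? p) (Fin.suc x ∈? _ ∷ p)

∣p∣≡∑𝟙∈ : ∀ {n} (p : Subset n) → ∣ p ∣ ≡ ∑[ x < n ] 𝟙 (x ∈? p)
∣p∣≡∑𝟙∈ []                    = refl
∣p∣≡∑𝟙∈ {suc n} (inside  ∷ p) = cong suc (trans (∣p∣≡∑𝟙∈ p) (sum-cong-≗ {n} (𝟙-∈?-there p)))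
∣p∣≡∑𝟙∈ {suc n} (outside ∷ p) = trans (∣p∣≡∑𝟙∈ p) (sum-cong-≗ {n} (𝟙-∈?-there p))

-- A sum over a list, taken over its positions so that the Fin-indexed sum lemmas apply.
∑⟨_⟩ : ∀ {a} {A : Set a} → List A → (A → ℕ) → ℕ
∑⟨ xs ⟩ f = ∑[ i < length xs ] f (List.lookup xs i)

length-filter≡∑𝟙 : ∀ {a p} {A : Set a} {P : Pred A p} (P? : Decidable P) xs →
                   length (filter P? xs) ≡ ∑⟨ xs ⟩ (𝟙 ∘ P?)
length-filter≡∑𝟙 P? []       = refl
length-filter≡∑𝟙 P? (x ∷ xs) with P? x
... | yes _ = cong suc (length-filter≡∑𝟙 P? xs)
... | no _  = length-filter≡∑𝟙 P? xs

∈-allSubsets : ∀ {n} (V : Subset n) → V ∈ₗ allSubsets n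
∈-allSubsets []           = Any.here refl
∈-allSubsets (inside ∷ V)  = ∈-++⁺ˡ (∈-map⁺ (inside ∷_) (∈-allSubsets V))
∈-allSubsets {suc n} (outside ∷ V) =
  ∈-++⁺ʳ (map (inside ∷_) (allSubsets n)) (∈-map⁺ (outside ∷_) (∈-allSubsets V))

allSubsets-unique : ∀ n → Unique (allSubsets n)
allSubsets-unique zero    = [] ∷ []
allSubsets-unique (suc n) = Unique.++⁺ (Unique.map⁺ ∷-injectiveʳ (allSubsets-unique n))
                                       (Unique.map⁺ ∷-injectiveʳ (allSubsets-unique n))
                                       heads-differ
  where
  heads-differ : ∀ {V} → ¬ (V ∈ₗ map (inside ∷_) (allSubsets n) × V ∈ₗ map (outside ∷_) (allSubsets n))
  heads-differ (V∈in , V∈out) with ∈-map⁻ (inside ∷_) V∈in | ∈-map⁻ (outside ∷_) V∈out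
  ... | _ , _ , refl | _ , _ , ()

map-bijection-↭ : ∀ {a} {A : Set a} {xs : List A} → Unique xs → (∀ x → x ∈ₗ xs) →
                  (σ τ : A → A) → (∀ x → σ (τ x) ≡ x) → (∀ x → τ (σ x) ≡ x) →
                  map σ xs ↭ xs
map-bijection-↭ {xs = xs} xs! xs-complete σ τ στ τσ = ∼bag⇒↭ (unique∧set⇒bag
  (Unique.map⁺ σ-injective xs!) xs!
  (λ {x} → mk⇔ (λ _ → xs-complete x) (λ _ → subst (_∈ₗ map σ xs) (στ x) (∈-map⁺ σ (xs-complete (τ x))))))
  where
  σ-injective : ∀ {x y} → σ x ≡ σ y → x ≡ y
  σ-injective {x} {y} σx≡σy = trans (sym (τσ x)) (trans (cong τ σx≡σy) (τσ y))

length-filter-map : ∀ {a b p} {A : Set a} {B : Set b} {P : Pred B p} (P? : Decidable P) (f : A → B) xs →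
                    length (filter P? (map f xs)) ≡ length (filter (P? ∘ f) xs)
length-filter-map P? f []       = refl
length-filter-map P? f (x ∷ xs) with P? (f x)
... | yes _ = cong suc (length-filter-map P? f xs)
... | no _  = length-filter-map P? f xs

∈-⋃ᶠ⁻ : ∀ {n k} (As : Fin k → Subset n) {x} → x ∈ ⋃ᶠ As → ∃ λ i → x ∈ As i
∈-⋃ᶠ⁻ {k = zero}  As x∈⊥ = contradiction x∈⊥ ∉⊥
∈-⋃ᶠ⁻ {k = suc k} As x∈⋃ with x∈p∪q⁻ (As Fin.zero) (⋃ᶠ (As ∘ Fin.suc)) x∈⋃
... | inj₁ x∈A₀ = Fin.zero , x∈A₀
... | inj₂ x∈⋃′ with ∈-⋃ᶠ⁻ (As ∘ Fin.suc) x∈⋃′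
...   | i , x∈Aᵢ = Fin.suc i , x∈Aᵢ

x∈p─q⇒x∉q : ∀ {n x} (p q : Subset n) → x ∈ p ─ q → x ∉ q
x∈p─q⇒x∉q (inside ∷ p)  (outside ∷ q) here          ()
x∈p─q⇒x∉q (_ ∷ p)       (_ ∷ q)       (there x∈p─q) (there x∈q) = x∈p─q⇒x∉q p q x∈p─q x∈q

length-filter-×-dec : ∀ {a p q} {A : Set a} {P : Pred A p} {Q : Pred A q} (P? : Decidable P) (Q? : Decidable Q) xs →
                      length (filter (λ x → P? x ×-dec Q? x) xs) ≡ length (filter P? (filter Q? xs))
length-filter-×-dec P? Q? []       = refl
length-filter-×-dec P? Q? (x ∷ xs) with Q? x
... | yes _ with P? x
...   | yes _ = cong suc (length-filter-×-dec P? Q? xs)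
...   | no _  = length-filter-×-dec P? Q? xs
length-filter-×-dec P? Q? (x ∷ xs) | no _ with P? x
...   | yes _ = length-filter-×-dec P? Q? xs
...   | no _  = length-filter-×-dec P? Q? xs

∑⟨⟩-cong-∈ : ∀ {a} {A : Set a} {xs : List A} {f g : A → ℕ} →
             (∀ {x} → x ∈ₗ xs → f x ≡ g x) → ∑⟨ xs ⟩ f ≡ ∑⟨ xs ⟩ g
∑⟨⟩-cong-∈ {xs = xs} f≡g = sum-cong-≗ {length xs} (λ i → f≡g (∈-lookup i))

-- Decks are definitionally instances of countSubsets:
-- deckCount G S j U ≡ countSubsets (λ V → (∣ V ∣ ≟ j) ×-dec isTranslateOf? G V U) S.
countSubsets : ∀ {n ℓ} {R : Pred (Subset n) ℓ} → Decidable R → Subset n → ℕ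
countSubsets {n} R? S = length (filter (λ V → (V ⊆? S) ×-dec R? V) (allSubsets n))

countSubsets≡∑ : ∀ {n ℓ} {R : Pred (Subset n) ℓ} (R? : Decidable R) S →
                 countSubsets R? S ≡ ∑⟨ filter R? (allSubsets n) ⟩ (λ V → 𝟙 (V ⊆? S))
countSubsets≡∑ {n} R? S = trans (length-filter-×-dec (_⊆? S) R? (allSubsets n))
                                (length-filter≡∑𝟙 (_⊆? S) (filter R? (allSubsets n)))

module Translation {n} (G : FinAbGroup n) where
  open FinAbGroup G using (0#; -_; isAbelianGroup) renaming (_+_ to _⊕_)

  abelianGroup : AbelianGroup 0ℓ 0ℓ
  abelianGroup = record { isAbelianGroup = isAbelianGroup }

  open import Algebra.Properties.AbelianGroup abelianGroup
    using (//-rightDividesˡ; //-rightDividesʳ; ⁻¹-∙-comm; ε⁻¹≈ε)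
  open IsAbelianGroup isAbelianGroup public using (_-_)
  open IsAbelianGroup isAbelianGroup using (assoc; identityʳ; inverseˡ; inverseʳ)

  x-a-b≡x-[a+b] : ∀ x a b → x - a - b ≡ x - (a ⊕ b)
  x-a-b≡x-[a+b] x a b = trans (assoc x (- a) (- b)) (cong (x ⊕_) (⁻¹-∙-comm a b))

  lookup-translate : ∀ g V x → lookup (translate G g V) x ≡ lookup V (x - g)
  lookup-translate g V x = lookup∘tabulate _ x

  ∈-translate⁺ : ∀ {g V x} → x - g ∈ V → x ∈ translate G g V
  ∈-translate⁺ {g} {V} {x} x-g∈V =
    lookup⇒[]= x _ (trans (lookup-translate g V x) ([]=⇒lookup x-g∈V))

  ∈-translate⁻ : ∀ {g V x} → x ∈ translate G g V → x - g ∈ V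
  ∈-translate⁻ {g} {V} {x} x∈gV =
    lookup⇒[]= _ V (trans (sym (lookup-translate g V x)) ([]=⇒lookup x∈gV))

  ∈-translate-⊕ : ∀ x {V v} → v ∈ V → v ⊕ x ∈ translate G x V
  ∈-translate-⊕ x {V} {v} v∈V = ∈-translate⁺ (subst (_∈ V) (sym (//-rightDividesʳ x v)) v∈V)

  translate-translate : ∀ a b V → translate G a (translate G b V) ≡ translate G (a ⊕ b) V
  translate-translate a b V = tabulate-cong λ x →
    trans (lookup-translate b V (x - a)) (cong (lookup V) (x-a-b≡x-[a+b] x a b))

  translate-identity : ∀ V → translate G 0# V ≡ V
  translate-identity V = trans (tabulate-cong λ x → cong (lookup V) (x-0≡x x)) (tabulate∘lookup V)
    where
    x-0≡x : ∀ x → x - 0# ≡ x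
    x-0≡x x = trans (cong (x ⊕_) ε⁻¹≈ε) (identityʳ x)

  translate-cancel : ∀ a b V → a ⊕ b ≡ 0# → translate G a (translate G b V) ≡ V
  translate-cancel a b V a⊕b≡0 = begin
    translate G a (translate G b V) ≡⟨ translate-translate a b V ⟩
    translate G (a ⊕ b) V           ≡⟨ cong (λ c → translate G c V) a⊕b≡0 ⟩
    translate G 0# V                ≡⟨ translate-identity V ⟩
    V                               ∎
    where open ≡-Reasoning

  translate-inverseˡ : ∀ x V → translate G (- x) (translate G x V) ≡ V
  translate-inverseˡ x V = translate-cancel (- x) x V (inverseˡ x)

  translate-inverseʳ : ∀ x V → translate G x (translate G (- x) V) ≡ V
  translate-inverseʳ x V = translate-cancel x (- x) V (inverseʳ x)

  translate-⊆ : ∀ x {V W} → V ⊆ W → translate G x V ⊆ translate G x W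
  translate-⊆ x V⊆W = ∈-translate⁺ ∘ V⊆W ∘ ∈-translate⁻

  translate-⊆⁻ : ∀ x {V W} → translate G x V ⊆ translate G x W → V ⊆ W
  translate-⊆⁻ x {V} {W} xV⊆xW =
    subst₂ _⊆_ (translate-inverseˡ x V) (translate-inverseˡ x W) (translate-⊆ (- x) xV⊆xW)

  translate-∩-nonempty⁺ : ∀ x {V W} → Nonempty (V ∩ W) →
                          Nonempty (translate G x V ∩ translate G x W)
  translate-∩-nonempty⁺ x {V} {W} (v , v∈V∩W) with x∈p∩q⁻ V W v∈V∩W
  ... | v∈V , v∈W = v ⊕ x , x∈p∩q⁺ (∈-translate-⊕ x v∈V , ∈-translate-⊕ x v∈W)

  translate-∩-nonempty⁻ : ∀ x {V W} → Nonempty (translate G x V ∩ translate G x W) →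
                          Nonempty (V ∩ W)
  translate-∩-nonempty⁻ x {V} {W} (w , w∈xV∩xW) with x∈p∩q⁻ (translate G x V) (translate G x W) w∈xV∩xW
  ... | w∈xV , w∈xW = w - x , x∈p∩q⁺ (∈-translate⁻ w∈xV , ∈-translate⁻ w∈xW)

  ∑-translate : ∀ x (f : Fin n → ℕ) → ∑[ y < n ] f (y - x) ≡ ∑[ y < n ] f y
  ∑-translate x = ∑-reindex (_- x) (_⊕ x) (//-rightDividesʳ x) (//-rightDividesˡ x)

  ∣translate∣ : ∀ x V → ∣ translate G x V ∣ ≡ ∣ V ∣
  ∣translate∣ x V = begin
    ∣ translate G x V ∣                   ≡⟨ ∣p∣≡∑𝟙∈ (translate G x V) ⟩
    ∑[ y < n ] 𝟙 (y ∈? translate G x V)  ≡⟨ sum-cong-≗ {n} (λ y → 𝟙-⇔ ∈-translate⁻ ∈-translate⁺ _ _) ⟩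
    ∑[ y < n ] 𝟙 (y - x ∈? V)            ≡⟨ ∑-translate x (λ y → 𝟙 (y ∈? V)) ⟩
    ∑[ y < n ] 𝟙 (y ∈? V)                ≡⟨ ∣p∣≡∑𝟙∈ V ⟨
    ∣ V ∣                                ∎
    where open ≡-Reasoning

  translate-isTranslateOf : ∀ x {V U} → IsTranslateOf G V U → IsTranslateOf G (translate G x V) U
  translate-isTranslateOf x {U = U} (g , V≡gU) =
    x ⊕ g , trans (cong (translate G x) V≡gU) (translate-translate x g U)

  translate-isTranslateOf⁻ : ∀ x {V U} → IsTranslateOf G (translate G x V) U → IsTranslateOf G V U
  translate-isTranslateOf⁻ x {V} {U} xV∼U = subst (λ W → IsTranslateOf G W U) (translate-inverseˡ x V)
                                                  (translate-isTranslateOf (- x) {translate G x V} {U} xV∼U)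

  countSubsets-translate : ∀ {ℓ} {R : Pred (Subset n) ℓ} (R? : Decidable R) x T →
    (∀ V → R V → R (translate G x V)) → (∀ V → R (translate G x V) → R V) →
    countSubsets R? (translate G x T) ≡ countSubsets R? T
  countSubsets-translate {R = R} R? x T R⇒xR xR⇒R = begin
    length (filter P? subsets)                       ≡⟨ ↭-length (filter-↭ P? translation-permutes) ⟨
    length (filter P? (map (translate G x) subsets)) ≡⟨ length-filter-map P? (translate G x) subsets ⟩
    length (filter (P? ∘ translate G x) subsets)     ≡⟨ cong length (filter-≐ (P? ∘ translate G x) Q? (to , from) subsets) ⟩
    length (filter Q? subsets)                       ∎
    where
    open ≡-Reasoning
    subsets = allSubsets n
    P? = λ V → (V ⊆? translate G x T) ×-dec R? V
    Q? = λ V → (V ⊆? T) ×-dec R? V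
    translation-permutes : map (translate G x) subsets ↭ subsets
    translation-permutes = map-bijection-↭ (allSubsets-unique n) ∈-allSubsets (translate G x) (translate G (- x))
                                           (translate-inverseʳ x) (translate-inverseˡ x)
    to : ∀ {V} → translate G x V ⊆ translate G x T × R (translate G x V) → V ⊆ T × R V
    to (xV⊆xT , RxV) = translate-⊆⁻ x xV⊆xT , xR⇒R _ RxV
    from : ∀ {V} → V ⊆ T × R V → translate G x V ⊆ translate G x T × R (translate G x V)
    from (V⊆T , RV) = translate-⊆ x V⊆T , R⇒xR _ RV

  deckCount-translate : ∀ x T j U → deckCount G (translate G x T) j U ≡ deckCount G T j U
  deckCount-translate x T j U = countSubsets-translate (λ V → (∣ V ∣ ≟ j) ×-dec isTranslateOf? G V U) x T
    (λ V (∣V∣≡j , V∼U) → trans (∣translate∣ x V) ∣V∣≡j , translate-isTranslateOf x {V} {U} V∼U)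
    (λ V (∣xV∣≡j , xV∼U) → trans (sym (∣translate∣ x V)) ∣xV∣≡j , translate-isTranslateOf⁻ x {V} {U} xV∼U)

module Cosets {n} (G : FinAbGroup n) {H : Subset n} (H≤G : IsSubgroup G H) where
  open FinAbGroup G using (0#; -_; isAbelianGroup) renaming (_+_ to _⊕_)
  open IsAbelianGroup isAbelianGroup using (assoc; comm; identityˡ; inverseˡ)
  open Translation G
  open import Algebra.Properties.AbelianGroup abelianGroup using (⁻¹-anti-homo-//; //-rightDividesˡ)
  open IsSubgroup H≤G

  x-y⊕y-z≡x-z : ∀ x y z → (x - y) ⊕ (y - z) ≡ x - z
  x-y⊕y-z≡x-z x y z = begin
    (x ⊕ - y) ⊕ (y ⊕ - z)  ≡⟨ assoc x (- y) (y ⊕ - z) ⟩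
    x ⊕ (- y ⊕ (y ⊕ - z))  ≡⟨ cong (x ⊕_) (assoc (- y) y (- z)) ⟨
    x ⊕ ((- y ⊕ y) ⊕ - z)  ≡⟨ cong (λ e → x ⊕ (e ⊕ - z)) (inverseˡ y) ⟩
    x ⊕ (0# ⊕ - z)         ≡⟨ cong (x ⊕_) (identityˡ (- z)) ⟩
    x ⊕ - z                ∎
    where open ≡-Reasoning

  x⊕[y-x]≡y : ∀ x y → x ⊕ (y - x) ≡ y
  x⊕[y-x]≡y x y = trans (comm x (y - x)) (//-rightDividesˡ x y)

  ∈-coset-sym : ∀ {x y} → x ∈ coset G H y → y ∈ coset G H x
  ∈-coset-sym {x} {y} x∈yH =
    ∈-translate⁺ (subst (_∈ H) (⁻¹-anti-homo-// x y) (neg-closed (∈-translate⁻ x∈yH)))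

  ∈-coset-trans : ∀ {x y z} → x ∈ coset G H y → y ∈ coset G H z → x ∈ coset G H z
  ∈-coset-trans {x} {y} {z} x∈yH y∈zH =
    ∈-translate⁺ (subst (_∈ H) (x-y⊕y-z≡x-z x y z) (+-closed (∈-translate⁻ x∈yH) (∈-translate⁻ y∈zH)))

  coset-≡ : ∀ {x y} → x ∈ coset G H y → coset G H x ≡ coset G H y
  coset-≡ x∈yH = ⊆-antisym (λ z∈xH → ∈-coset-trans z∈xH x∈yH)
                           (λ z∈yH → ∈-coset-trans z∈yH (∈-coset-sym x∈yH))

  translate-coset : ∀ x y → translate G x (coset G H (y - x)) ≡ coset G H y
  translate-coset x y = trans (translate-translate x (y - x) H) (cong (coset G H) (x⊕[y-x]≡y x y))

  ∑𝟙∈coset≡∣H∣ : ∀ x → ∑[ y < n ] 𝟙 (y ∈? coset G H x) ≡ ∣ H ∣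
  ∑𝟙∈coset≡∣H∣ x = trans (sym (∣p∣≡∑𝟙∈ (coset G H x))) (∣translate∣ x H)

  1≤∣H∣ : 1 ≤ ∣ H ∣
  1≤∣H∣ = subst (_≤ ∣ H ∣) (∣⁅x⁆∣≡1 0#) (p⊆q⇒∣p∣≤∣q∣ ⁅0⁆⊆H)
    where
    ⁅0⁆⊆H : ⁅ 0# ⁆ ⊆ H
    ⁅0⁆⊆H x∈⁅0⁆ = subst (_∈ H) (sym (x∈⁅y⁆⇒x≡y 0# x∈⁅0⁆)) 0∈H

  -- The number of y whose coset y + H meets V, i.e. the size of V + H.
  ∣_+H∣ : Subset n → ℕ
  ∣ V +H∣ = ∑[ y < n ] 𝟙 (nonempty? (V ∩ coset G H y))

  ∣+H∣-translate : ∀ x V → ∣ translate G x V +H∣ ≡ ∣ V +H∣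
  ∣+H∣-translate x V = begin
    ∑[ y < n ] 𝟙 (nonempty? (translate G x V ∩ coset G H y))
      ≡⟨ sum-cong-≗ {n} (λ y → 𝟙-⇔ (to y) (from y) _ _) ⟩
    ∑[ y < n ] 𝟙 (nonempty? (V ∩ coset G H (y - x)))
      ≡⟨ ∑-translate x (λ y → 𝟙 (nonempty? (V ∩ coset G H y))) ⟩
    ∑[ y < n ] 𝟙 (nonempty? (V ∩ coset G H y)) ∎
    where
    open ≡-Reasoning
    to : ∀ y → Nonempty (translate G x V ∩ coset G H y) → Nonempty (V ∩ coset G H (y - x))
    to y = translate-∩-nonempty⁻ x ∘ subst (λ C → Nonempty (translate G x V ∩ C)) (sym (translate-coset x y))
    from : ∀ y → Nonempty (V ∩ coset G H (y - x)) → Nonempty (translate G x V ∩ coset G H y)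
    from y = subst (λ C → Nonempty (translate G x V ∩ C)) (translate-coset x y) ∘ translate-∩-nonempty⁺ x

  ∣+H∣≤∣V∣*∣H∣ : ∀ V → ∣ V +H∣ ≤ ∣ V ∣ * ∣ H ∣
  ∣+H∣≤∣V∣*∣H∣ V = begin
    ∑[ y < n ] 𝟙 (nonempty? (V ∩ coset G H y)) ≤⟨ ∑-mono meets⇒witness ⟩
    ∑[ y < n ] ∑[ v < n ] witness y v          ≡⟨ ∑-comm witness ⟩
    ∑[ v < n ] ∑[ y < n ] witness y v          ≡⟨ sum-cong-≗ {n} (λ v → *-distribˡ-sum {n} (𝟙 (v ∈? V)) _) ⟨
    ∑[ v < n ] (𝟙 (v ∈? V) * ∑[ y < n ] 𝟙 (y ∈? coset G H v))
                                               ≡⟨ sum-cong-≗ {n} (λ v → cong (𝟙 (v ∈? V) *_) (∑𝟙∈coset≡∣H∣ v)) ⟩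
    ∑[ v < n ] (𝟙 (v ∈? V) * ∣ H ∣)            ≡⟨ *-distribʳ-sum {n} ∣ H ∣ (λ v → 𝟙 (v ∈? V)) ⟨
    (∑[ v < n ] 𝟙 (v ∈? V)) * ∣ H ∣            ≡⟨ cong (_* ∣ H ∣) (∣p∣≡∑𝟙∈ V) ⟨
    ∣ V ∣ * ∣ H ∣                              ∎
    where
    open ≤-Reasoning
    witness : Fin n → Fin n → ℕ
    witness y v = 𝟙 (v ∈? V) * 𝟙 (y ∈? coset G H v)
    meets⇒witness : ∀ y → 𝟙 (nonempty? (V ∩ coset G H y)) ≤ ∑[ v < n ] witness y v
    meets⇒witness y with nonempty? (V ∩ coset G H y)
    ... | no _ = z≤n
    ... | yes (v , v∈V∩yH) with x∈p∩q⁻ V (coset G H y) v∈V∩yH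
    ...   | v∈V , v∈yH = subst (_≤ ∑[ v < n ] witness y v)
                               (cong₂ _*_ (𝟙-yes v∈V (v ∈? V)) (𝟙-yes (∈-coset-sym v∈yH) (y ∈? coset G H v)))
                               (term≤∑ (witness y) v)

module CosetPartition {n} (G : FinAbGroup n) {H : Subset n} (H≤G : IsSubgroup G H)
  {k} (As : Fin k → Subset n) (g : Fin k → Fin n)
  (As⊆cosets : ∀ i → As i ⊆ coset G H (g i))
  (cosets-distinct : ∀ i j → i ≢ j → coset G H (g i) ≢ coset G H (g j)) where

  open Cosets G H≤G

  T : Subset n
  T = ⋃ᶠ As

  meets : Subset n → Fin k → ℕ
  meets V i = 𝟙 (nonempty? (V ∩ As i))

  avoids : Subset n → Fin k → ℕ
  avoids V i = 𝟙 (V ⊆? T ─ As i)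

  -- If y + H meets V ⊆ T at v ∈ As i, then y + H = g i + H, and the g j + H are pairwise distinct.
  meets-coset≡∑ : ∀ {V} → V ⊆ T → ∀ y →
    𝟙 (nonempty? (V ∩ coset G H y)) ≡ ∑[ i < k ] (𝟙 (y ∈? coset G H (g i)) * meets V i)
  meets-coset≡∑ {V} V⊆T y with nonempty? (V ∩ coset G H y)
  ... | yes (v , v∈V∩yH) with x∈p∩q⁻ V (coset G H y) v∈V∩yH
  ...   | v∈V , v∈yH with ∈-⋃ᶠ⁻ As (V⊆T v∈V)
  ...     | i , v∈Aᵢ = sym (begin
    ∑[ j < k ] term j                        ≡⟨ ∑-single term i other-terms ⟩
    𝟙 (y ∈? coset G H (g i)) * meets V i     ≡⟨ cong₂ _*_ (𝟙-yes y∈gᵢH (y ∈? coset G H (g i)))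
                                                          (𝟙-yes (v , x∈p∩q⁺ (v∈V , v∈Aᵢ)) (nonempty? (V ∩ As i))) ⟩
    1                                        ∎)
    where
    open ≡-Reasoning
    term : Fin k → ℕ
    term j = 𝟙 (y ∈? coset G H (g j)) * meets V j
    y∈gᵢH : y ∈ coset G H (g i)
    y∈gᵢH = subst (y ∈_) (coset-≡ (As⊆cosets i v∈Aᵢ)) (∈-coset-sym v∈yH)
    other-terms : ∀ j → j ≢ i → term j ≡ 0
    other-terms j j≢i = cong (_* meets V j) (𝟙-no y∉gⱼH (y ∈? coset G H (g j)))
      where
      y∉gⱼH : y ∉ coset G H (g j)
      y∉gⱼH y∈gⱼH = cosets-distinct j i j≢i (trans (sym (coset-≡ y∈gⱼH)) (coset-≡ y∈gᵢH))
  meets-coset≡∑ {V} V⊆T y | no V∩yH≡∅ = sym (∑-zero _ term≡0)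
    where
    term≡0 : ∀ i → 𝟙 (y ∈? coset G H (g i)) * meets V i ≡ 0
    term≡0 i with y ∈? coset G H (g i) | nonempty? (V ∩ As i)
    ... | no _      | _      = refl
    ... | yes _     | no _   = refl
    ... | yes y∈gᵢH | yes (v , v∈V∩Aᵢ) with x∈p∩q⁻ V (As i) v∈V∩Aᵢ
    ...   | v∈V , v∈Aᵢ = contradiction (v , x∈p∩q⁺ (v∈V , v∈yH)) V∩yH≡∅
      where
      v∈yH : v ∈ coset G H y
      v∈yH = subst (v ∈_) (sym (coset-≡ y∈gᵢH)) (As⊆cosets i v∈Aᵢ)

  ∣+H∣≡∑ : ∀ {V} → V ⊆ T → ∣ V +H∣ ≡ ∑[ i < k ] (∣ H ∣ * meets V i)
  ∣+H∣≡∑ {V} V⊆T = begin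
    ∑[ y < n ] 𝟙 (nonempty? (V ∩ coset G H y))
      ≡⟨ sum-cong-≗ {n} (meets-coset≡∑ V⊆T) ⟩
    ∑[ y < n ] ∑[ i < k ] (𝟙 (y ∈? coset G H (g i)) * meets V i)
      ≡⟨ ∑-comm (λ y i → 𝟙 (y ∈? coset G H (g i)) * meets V i) ⟩
    ∑[ i < k ] ∑[ y < n ] (𝟙 (y ∈? coset G H (g i)) * meets V i)
      ≡⟨ sum-cong-≗ {k} (λ i → *-distribʳ-sum {n} (meets V i) _) ⟨
    ∑[ i < k ] ((∑[ y < n ] 𝟙 (y ∈? coset G H (g i))) * meets V i)
      ≡⟨ sum-cong-≗ {k} (λ i → cong (_* meets V i) (∑𝟙∈coset≡∣H∣ (g i))) ⟩
    ∑[ i < k ] (∣ H ∣ * meets V i) ∎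
    where open ≡-Reasoning

  avoids+meets≡1 : ∀ {V} → V ⊆ T → ∀ i → avoids V i + meets V i ≡ 1
  avoids+meets≡1 {V} V⊆T i with V ⊆? T ─ As i | nonempty? (V ∩ As i)
  ... | yes _ | no _  = refl
  ... | no _  | yes _ = refl
  ... | yes V⊆T─Aᵢ | yes (v , v∈V∩Aᵢ) with x∈p∩q⁻ V (As i) v∈V∩Aᵢ
  ...   | v∈V , v∈Aᵢ = contradiction v∈Aᵢ (x∈p─q⇒x∉q T (As i) (V⊆T─Aᵢ v∈V))
  avoids+meets≡1 {V} V⊆T i | no V⊈T─Aᵢ | no V∩Aᵢ≡∅ = contradiction (λ {v} → V⊆T─Aᵢ {v}) V⊈T─Aᵢ
    where
    V⊆T─Aᵢ : V ⊆ T ─ As i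
    V⊆T─Aᵢ {v} v∈V = x∈p∧x∉q⇒x∈p─q (V⊆T v∈V) (λ v∈Aᵢ → V∩Aᵢ≡∅ (v , x∈p∩q⁺ (v∈V , v∈Aᵢ)))

  ∣H∣*∑avoids+∣+H∣≡k*∣H∣ : ∀ {V} → V ⊆ T → ∣ H ∣ * ∑[ i < k ] avoids V i + ∣ V +H∣ ≡ k * ∣ H ∣
  ∣H∣*∑avoids+∣+H∣≡k*∣H∣ {V} V⊆T = begin
    ∣ H ∣ * ∑[ i < k ] avoids V i + ∣ V +H∣
      ≡⟨ cong₂ _+_ (*-distribˡ-sum {k} ∣ H ∣ (avoids V)) (∣+H∣≡∑ V⊆T) ⟩
    ∑[ i < k ] (∣ H ∣ * avoids V i) + ∑[ i < k ] (∣ H ∣ * meets V i)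
      ≡⟨ ∑-distrib-+ (λ i → ∣ H ∣ * avoids V i) (λ i → ∣ H ∣ * meets V i) ⟨
    ∑[ i < k ] (∣ H ∣ * avoids V i + ∣ H ∣ * meets V i)
      ≡⟨ sum-cong-≗ {k} (λ i → sym (*-distribˡ-+ ∣ H ∣ (avoids V i) (meets V i))) ⟩
    ∑[ i < k ] (∣ H ∣ * (avoids V i + meets V i))
      ≡⟨ sum-cong-≗ {k} (λ i → trans (cong (∣ H ∣ *_) (avoids+meets≡1 V⊆T i)) (*-identityʳ ∣ H ∣)) ⟩
    ∑[ i < k ] ∣ H ∣
      ≡⟨ ∑-const k ∣ H ∣ ⟩
    k * ∣ H ∣ ∎
    where open ≡-Reasoning

  𝟙⊆T-identity : ∀ V → 𝟙 (V ⊆? T) * (k * ∣ H ∣) ≡ ∣ H ∣ * ∑[ i < k ] avoids V i + 𝟙 (V ⊆? T) * ∣ V +H∣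
  𝟙⊆T-identity V with V ⊆? T
  ... | yes V⊆T = trans (*-identityˡ (k * ∣ H ∣)) (sym (begin
    ∣ H ∣ * ∑[ i < k ] avoids V i + 1 * ∣ V +H∣ ≡⟨ cong (∣ H ∣ * ∑[ i < k ] avoids V i +_) (*-identityˡ ∣ V +H∣) ⟩
    ∣ H ∣ * ∑[ i < k ] avoids V i + ∣ V +H∣     ≡⟨ ∣H∣*∑avoids+∣+H∣≡k*∣H∣ V⊆T ⟩
    k * ∣ H ∣                                   ∎))
    where open ≡-Reasoning
  ... | no V⊈T  = sym (begin
    ∣ H ∣ * ∑[ i < k ] avoids V i + 0 ≡⟨ +-identityʳ _ ⟩
    ∣ H ∣ * ∑[ i < k ] avoids V i     ≡⟨ cong (∣ H ∣ *_) (∑-zero (avoids V) avoids≡0) ⟩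
    ∣ H ∣ * 0                         ≡⟨ *-zeroʳ ∣ H ∣ ⟩
    0                                 ∎)
    where
    open ≡-Reasoning
    avoids≡0 : ∀ i → avoids V i ≡ 0
    avoids≡0 i = 𝟙-no (λ V⊆T─Aᵢ → V⊈T (p─q⊆p T (As i) ∘ V⊆T─Aᵢ {_})) (V ⊆? T ─ As i)

  countSubsets-identity : ∀ {ℓ} {R : Pred (Subset n) ℓ} (R? : Decidable R) N → (∀ {V} → R V → ∣ V +H∣ ≡ N) →
    countSubsets R? T * (k * ∣ H ∣) ≡ ∣ H ∣ * ∑[ i < k ] countSubsets R? (T ─ As i) + countSubsets R? T * N
  countSubsets-identity R? N R⇒∣+H∣≡N = begin
    countSubsets R? T * (k * h)
      ≡⟨ cong (_* (k * h)) (countSubsets≡∑ R? T) ⟩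
    (∑⟨ L ⟩ t) * (k * h)
      ≡⟨ *-distribʳ-sum {length L} (k * h) (t ∘ List.lookup L) ⟩
    ∑⟨ L ⟩ (λ V → t V * (k * h))
      ≡⟨ ∑⟨⟩-cong-∈ term-identity ⟩
    ∑⟨ L ⟩ (λ V → h * ∑[ i < k ] avoids V i + t V * N)
      ≡⟨ ∑-distrib-+ (λ p → h * ∑[ i < k ] avoids (List.lookup L p) i) (λ p → t (List.lookup L p) * N) ⟩
    ∑⟨ L ⟩ (λ V → h * ∑[ i < k ] avoids V i) + ∑⟨ L ⟩ (λ V → t V * N)
      ≡⟨ cong₂ _+_ (*-distribˡ-sum {length L} h _) (*-distribʳ-sum {length L} N (t ∘ List.lookup L)) ⟨
    h * ∑⟨ L ⟩ (λ V → ∑[ i < k ] avoids V i) + (∑⟨ L ⟩ t) * N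
      ≡⟨ cong₂ (λ a b → h * a + b * N) (∑-comm {length L} {k} (λ p → avoids (List.lookup L p)))
                                        (sym (countSubsets≡∑ R? T)) ⟩
    h * ∑[ i < k ] ∑⟨ L ⟩ (λ V → avoids V i) + countSubsets R? T * N
      ≡⟨ cong (λ a → h * a + countSubsets R? T * N) (sum-cong-≗ {k} (λ i → sym (countSubsets≡∑ R? (T ─ As i)))) ⟩
    h * ∑[ i < k ] countSubsets R? (T ─ As i) + countSubsets R? T * N ∎
    where
    open ≡-Reasoning
    h = ∣ H ∣
    L = filter R? (allSubsets n)
    t : Subset n → ℕ
    t V = 𝟙 (V ⊆? T)
    term-identity : ∀ {V} → V ∈ₗ L → t V * (k * h) ≡ h * ∑[ i < k ] avoids V i + t V * N
    term-identity {V} V∈L = trans (𝟙⊆T-identity V)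
      (cong (λ a → h * ∑[ i < k ] avoids V i + t V * a) (R⇒∣+H∣≡N (proj₂ (∈-filter⁻ R? {xs = allSubsets n} V∈L))))

  deckCount-identity : ∀ j U →
    deckCount G T j U * (k * ∣ H ∣) ≡ ∣ H ∣ * ∑[ i < k ] deckCount G (T ─ As i) j U + deckCount G T j U * ∣ U +H∣
  deckCount-identity j U = countSubsets-identity (λ V → (∣ V ∣ ≟ j) ×-dec isTranslateOf? G V U) ∣ U +H∣
    (λ { (_ , x , V≡xU) → trans (cong ∣_+H∣ V≡xU) (∣+H∣-translate x U) })

affine-cancel : ∀ {a b X M K} → M < K → a * K ≡ X + a * M → b * K ≡ X + b * M → a ≡ b
affine-cancel {a} {b} {X} {M} {K} M<K aK≡X+aM bK≡X+bM =
  *-cancelʳ-≡ a b (K ∸ M) {{>-nonZero (m<n⇒0<n∸m M<K)}} (trans (gap {a} aK≡X+aM) (sym (gap {b} bK≡X+bM)))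
  where
  gap : ∀ {c} → c * K ≡ X + c * M → c * (K ∸ M) ≡ X
  gap {c} cK≡X+cM = begin
    c * (K ∸ M)        ≡⟨ *-distribˡ-∸ c K M ⟩
    c * K ∸ c * M      ≡⟨ cong (_∸ c * M) cK≡X+cM ⟩
    X + c * M ∸ c * M  ≡⟨ m+n∸n≡m X (c * M) ⟩
    X                  ∎
    where open ≡-Reasoning

theorem2p1 : ∀ {n} (G : FinAbGroup n) (H : Subset n) → IsSubgroup G H →
    (k : ℕ) → 1 ≤ k →
    (As : Fin k → Subset n) (g : Fin k → Fin n) →
    (∀ i → As i ⊆ coset G H (g i)) →
    (∀ i j → i ≢ j → coset G H (g i) ≢ coset G H (g j)) →
    (Bs : Fin k → Subset n) (g′ : Fin k → Fin n) →
    (∀ i → Bs i ⊆ coset G H (g′ i)) →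
    (∀ i j → i ≢ j → coset G H (g′ i) ≢ coset G H (g′ j)) →
    (∀ i → ∃ λ x → (⋃ᶠ Bs ─ Bs i) ≡ translate G x (⋃ᶠ As ─ As i)) →
    Indistinguishable G (k ∸ 1) (⋃ᶠ As) (⋃ᶠ Bs)
theorem2p1 G H H≤G (suc k) (s≤s z≤n) As g As⊆ distinct Bs g′ Bs⊆ distinct′ translates j j≤k U ∣U∣≡j =
  affine-cancel ∣U+H∣<[1+k]*∣H∣ (A.deckCount-identity j U)
    (subst (λ s → deckCount G B.T j U * (suc k * ∣ H ∣) ≡ ∣ H ∣ * s + deckCount G B.T j U * ∣ U +H∣)
           removals-agree (B.deckCount-identity j U))
  where
  open Cosets G H≤G
  open Translation G
  module A = CosetPartition G H≤G As g As⊆ distinct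
  module B = CosetPartition G H≤G Bs g′ Bs⊆ distinct′

  removals-agree : ∑[ i < suc k ] deckCount G (B.T ─ Bs i) j U ≡ ∑[ i < suc k ] deckCount G (A.T ─ As i) j U
  removals-agree = sum-cong-≗ {suc k} λ i →
    trans (cong (λ S → deckCount G S j U) (proj₂ (translates i)))
          (deckCount-translate (proj₁ (translates i)) (A.T ─ As i) j U)

  ∣U+H∣<[1+k]*∣H∣ : ∣ U +H∣ < suc k * ∣ H ∣
  ∣U+H∣<[1+k]*∣H∣ = ≤-<-trans (subst (λ m → ∣ U +H∣ ≤ m * ∣ H ∣) ∣U∣≡j (∣+H∣≤∣V∣*∣H∣ U))
                              (*-monoˡ-< ∣ H ∣ {{>-nonZero 1≤∣H∣}} (s≤s j≤k))
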